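{- For every injective word $W$ over $\overline{\mathbb{Z}}$, $\mathrm{Supp}(F(W))=\Omega(W)$. In particular, $W$ is an $\Omega$-parking word if and only if $F(W)$ has support $\{1,\dots,|W|\}$.
   Context: $\overline{\mathbb{Z}}$ is the set of symbols $(i,j)$, $i\in\mathbb{Z}$, $j\ge1$, totally ordered lexicographically, with $\mathrm{val}(i,j)=i$. A word is injective if its letters are distinct. Indexed forests: for finite $S\subset\mathbb{Z}$ with maximal consecutive blocks $I_1<\cdots<I_k$, an indexed forest with support $S$ is a tuple of plane binary trees $T_j$ with $|I_j|$ nodes, canonically labeled by $I_j$ in inorder. Insertion $W\mapsto(F(W),P(W))$, with $P(W)$ a node labeling by letters of $W$: for $W$ empty, $F(W)$ is empty. For $W=W'a$, let $F'=F(W')$ have blocks $I_1<\cdots<I_k$, roots $u_j$ and root labels $a_j=P(W')(u_j)$, and let $i=\mathrm{val}(a)$. Add a new root $u$ labeled $a$ as follows. (i) If $i\notin\mathrm{Supp}(F')$: $u$ has canonical label $i$, left child $u_j$ if $i-1\in I_j$ (else none), and right child $u_{j'}$ if $i+1\in I_{j'}$ (else none). (ii) If $i\in I_j$ and $a>a_j$: the left child is $u_j$, the right child is $u_{j+1}$ if $\max I_j+2\in\mathrm{Supp}(F')$ (else none), and the support gains $\max I_j+1$. (iii) If $i\in I_j$ and $a<a_j$: the right child is $u_j$, the left child is $u_{j-1}$ if $\min I_j-2\in\mathrm{Supp}(F')$ (else none), and the support gains $\min I_j-1$. Other trees are unchanged. $\Omega$-parking: $\Omega(\text{empty})=\emptyset$.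 For $W=W'a$: if $\mathrm{val}(a)\notin\Omega(W')$, set $\Omega(W)=\Omega(W')\cup\{\mathrm{val}(a)\}$. Otherwise $\mathrm{val}(a)$ lies in a maximal interval $I$ of consecutive integers in $\Omega(W')$; let $W_i$ be the last letter of $W'$ with $\mathrm{val}(W_i)\in I$, and set $\Omega(W)=\Omega(W')\cup\{\min I-1\}$ if $a<W_i$, and $\Omega(W)=\Omega(W')\cup\{\max I+1\}$ if $a>W_i$. $W$ is an $\Omega$-parking word if $\Omega(W)=\{1,\dots,|W|\}$. -}

module Defs where

open import Data.Bool using (Bool; true; false; if_then_else_)
open import Data.Nat using (ℕ; zero; suc) renaming (_+_ to _+ℕ_; _≤_ to _≤ℕ_; _<_ to _<ℕ_; _<?_ to _<ℕ?_)
open import Data.Integer using (ℤ; +_; _+_; _-_; 1ℤ; _≤_; _<_; _≤?_; _<?_; _≟_)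
open import Data.List using (List; []; _∷_; foldl; concatMap; map; upTo; length)
open import Data.List.Membership.Propositional using (_∈_)
open import Data.List.Membership.DecPropositional _≟_ using (_∈?_)
open import Data.Maybe using (Maybe; just; nothing)
open import Data.Product using (_×_; _,_)
open import Data.Sum using (_⊎_)
open import Relation.Binary.PropositionalEquality using (_≡_)
open import Relation.Nullary using (Dec; does)
open import Relation.Nullary.Decidable using (_⊎-dec_; _×-dec_)
open import Function.Bundles using (_⇔_)

-- Letters of Z̄ : symbols (i , j) with i ∈ ℤ, j ≥ 1, ordered lexicographically

record Letter : Set where
  constructor mkLetter
  field
    val     : ℤ
    idx     : ℕ
    idx≥1   : 1 ≤ℕ idx
open Letter public

_<ᴸ_ : Letter → Letter → Set
a <ᴸ b = (val a < val b) ⊎ ((val a ≡ val b) × (idx a <ℕ idx b))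

_<ᴸ?_ : (a b : Letter) → Dec (a <ᴸ b)
a <ᴸ? b = (val a <? val b) ⊎-dec ((val a ≟ val b) ×-dec (idx a <ℕ? idx b))

Word : Set
Word = List Letter

data Tree : Set where
  leaf : Tree
  node : Tree → Letter → Tree → Tree

size : Tree → ℕ
size leaf = 0
size (node l _ r) = suc (size l +ℕ size r)

root : Tree → Maybe Letter
root leaf = nothing
root (node _ a _) = just a

-- A component: a tree T_j together with its block I_j = [lo , lo + |T_j| - 1];
-- the canonical labels of the nodes are lo, lo+1, ... in inorder.
record Comp : Set where
  constructor comp
  field
    lo   : ℤ
    tree : Tree
open Comp public

hi : Comp → ℤ
hi c = lo c + + size (tree c) - 1ℤ

-- An indexed forest: its components (one per maximal block of the support).
Forest : Set
Forest = List Comp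

range : ℤ → ℕ → List ℤ
range z n = map (λ k → z + + k) (upTo n)

block : Comp → List ℤ
block c = range (lo c) (size (tree c))

Supp : Forest → List ℤ
Supp F = concatMap block F

pick : (Comp → Bool) → Forest → Maybe Comp × Forest
pick p [] = nothing , []
pick p (c ∷ cs) with p c
... | true  = just c , cs
... | false with pick p cs
...   | (m , cs') = m , c ∷ cs'

treeOr : Maybe Comp → Tree
treeOr nothing  = leaf
treeOr (just c) = tree c

loOr : Maybe Comp → ℤ → ℤ
loOr nothing  z = z
loOr (just c) _ = lo c

inBlock : ℤ → Comp → Bool
inBlock i c = does ((lo c ≤? i) ×-dec (i ≤? hi c))

belowRoot : Letter → Comp → Bool
belowRoot a c with root (tree c)
... | just r  = does (a <ᴸ? r)
... | nothing = false

insert : Forest → Letter → Forest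
insert F a with pick (inBlock (val a)) F
... | (nothing , _) =
  let i = val a
      (l , F₁) = pick (λ c → does (hi c ≟ (i - 1ℤ))) F
      (r , F₂) = pick (λ c → does (lo c ≟ (i + 1ℤ))) F₁
  in comp (loOr l i) (node (treeOr l) a (treeOr r)) ∷ F₂
... | (just c , F₁) with belowRoot a c
...   | false =
  let (r , F₂) = pick (λ d → does (lo d ≟ (hi c + 1ℤ + 1ℤ))) F₁
  in comp (lo c) (node (tree c) a (treeOr r)) ∷ F₂
...   | true =
  let (l , F₂) = pick (λ d → does (hi d ≟ (lo c - 1ℤ - 1ℤ))) F₁
  in comp (loOr l (lo c - 1ℤ)) (node (treeOr l) a (tree c)) ∷ F₂

F : Word → Forest
F W = foldl insert [] W

lowEnd : ℕ → List ℤ → ℤ → ℤ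
lowEnd zero    S x = x
lowEnd (suc n) S x = if does ((x - 1ℤ) ∈? S) then lowEnd n S (x - 1ℤ) else x

highEnd : ℕ → List ℤ → ℤ → ℤ
highEnd zero    S x = x
highEnd (suc n) S x = if does ((x + 1ℤ) ∈? S) then highEnd n S (x + 1ℤ) else x

-- last letter (pre is the reversed prefix) whose value lies in [l , h]
lastIn : ℤ → ℤ → List Letter → Maybe Letter
lastIn l h [] = nothing
lastIn l h (b ∷ pre) =
  if does ((l ≤? val b) ×-dec (val b ≤? h)) then just b else lastIn l h pre

-- one step of Ω : S = Ω(W'), pre = reverse W', a the new letter
Ωstep : List ℤ → List Letter → Letter → List ℤ
Ωstep S pre a with does (val a ∈? S)
... | false = val a ∷ S
... | true with lowEnd (length S) S (val a) | highEnd (length S) S (val a)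
...   | l | h with lastIn l h pre
...     | just Wi = if does (a <ᴸ? Wi) then (l - 1ℤ) ∷ S else (h + 1ℤ) ∷ S
...     | nothing = S   -- never happens (I always contains a value of W')

Ωgo : Word → List ℤ → List Letter → List ℤ
Ωgo []      S pre = S
Ωgo (a ∷ W) S pre = Ωgo W (Ωstep S pre a) (a ∷ pre)

Ω : Word → List ℤ
Ω W = Ωgo W [] []

_≐_ : List ℤ → List ℤ → Set
A ≐ B = ∀ x → (x ∈ A) ⇔ (x ∈ B)

IsOneTo : List ℤ → ℕ → Set
IsOneTo A n = ∀ x → (x ∈ A) ⇔ ((1ℤ ≤ x) × (x ≤ + n))

ΩParking : Word → Set
ΩParking W = IsOneTo (Ω W) (length W)

module Submission where

-- Supp F(W) and Ω(W) are kept equal by a stronger invariant: the blocks of F(W) are exactly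
-- the maximal intervals of Ω(W), and the root of each tree is labelled by the last letter of W
-- whose value lies in its block. Then the letter W_i consulted by the Ω-rule is the root label
-- a_j of the block containing val a, so insertion cases (ii) and (iii) add max I + 1 and
-- min I - 1 exactly as Ω does, and case (i) adds val a. In every case the new tree joins the
-- (possibly empty) blocks on either side of the new point under a root labelled a, so it again
-- spans a maximal interval and its root is the last letter read in it.

open import Defs
open import Data.Bool using (Bool; true; false; if_then_else_)
open import Data.Empty using (⊥; ⊥-elim)
open import Data.Integer
  using (ℤ; +_; _+_; _-_; -_; 1ℤ; -1ℤ; _≤_; _<_; _≤?_; _≟_; +≤+; +<+; ∣_∣)
open import Data.Integer.Properties
open import Data.Integer.Tactic.RingSolver using (solve-∀)
open import Data.List using (List; []; _∷_; [_]; _++_; map; foldl; length)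
open import Data.List.Membership.Propositional using (_∈_; _∉_; lose; find)
open import Data.List.Membership.Propositional.Properties using (∈-map⁻; ∈-map⁺; ∈-upTo⁺; ∈-upTo⁻; ∈-++⁺ʳ)
open import Data.List.Membership.DecPropositional _≟_ using (_∈?_)
open import Data.List.Relation.Binary.Permutation.Propositional
  using (_↭_; ↭-refl; ↭-sym; ↭-trans; ↭-prep; ↭-swap; ↭⇒↭ₛ)
open import Data.List.Relation.Binary.Permutation.Propositional.Properties
  using (All-resp-↭; Any-resp-↭; map⁺; ++⁺ˡ; shift)
open import Data.List.Relation.Unary.All as All using (All; []; _∷_)
open import Data.List.Relation.Unary.AllPairs as AllPairs using (AllPairs; []; _∷_)
open import Data.List.Relation.Unary.Any as Any using (Any; here; there)
open import Data.List.Relation.Unary.Any.Properties using (concatMap⁺; concatMap⁻; ++⁻)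
open import Data.List.Relation.Unary.All.Properties using (All¬⇒¬Any)
open import Data.List.Relation.Unary.Unique.Propositional using (Unique)
open import Data.Maybe using (Maybe; just; nothing)
open import Data.Nat as ℕ using (ℕ; zero; suc)
import Data.Nat.Properties as ℕ
open import Data.Nat.ListAction using (sum)
open import Data.Nat.ListAction.Properties using (sum-↭)
open import Data.Product using (∃; _×_; _,_; proj₁; proj₂)
open import Data.Sum using (_⊎_; inj₁; inj₂)
open import Function using (_∘_)
open import Function.Bundles using (_⇔_; mk⇔; Equivalence)
open import Function.Properties.Equivalence using () renaming (sym to ⇔-sym; trans to ⇔-trans)
open import Relation.Binary.PropositionalEquality
  using (_≡_; _≢_; refl; sym; trans; cong; subst; subst₂; setoid; resp₂; ≢-sym; module ≡-Reasoning)
open import Data.List.Relation.Binary.Permutation.Setoid.Properties (setoid Comp) using (AllPairs-resp-↭)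
open import Relation.Nullary using (¬_; Dec; yes; no; does)
open import Relation.Nullary.Decidable using (_×-dec_)
open import Relation.Binary.Definitions using (tri<; tri≈; tri>)

i-1+1≡i : ∀ i → i - 1ℤ + 1ℤ ≡ i
i-1+1≡i = solve-∀

i+1-1≡i : ∀ i → i + 1ℤ - 1ℤ ≡ i
i+1-1≡i = solve-∀

i+[1+n]≡i+1+n : ∀ i n → i + + suc n ≡ i + 1ℤ + + n
i+[1+n]≡i+1+n i n = trans (cong (λ t → i + t) (pos-+ 1 n)) (reassoc i (+ n))
  where
  reassoc : ∀ i j → i + (1ℤ + j) ≡ i + 1ℤ + j
  reassoc = solve-∀

i+[1+n]-1≡i+n : ∀ i n → i + + suc n - 1ℤ ≡ i + + n
i+[1+n]-1≡i+n i n = trans (cong (_- 1ℤ) (i+[1+n]≡i+1+n i n)) (reassoc i (+ n))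
  where
  reassoc : ∀ i j → i + 1ℤ + j - 1ℤ ≡ i + j
  reassoc = solve-∀

i<j⇒i≤j-1 : ∀ {i j} → i < j → i ≤ j - 1ℤ
i<j⇒i≤j-1 {i} {j} p = subst (i ≤_) (+-comm -1ℤ j) (i<j⇒i≤pred[j] p)

i≤j-1⇒i<j : ∀ {i j} → i ≤ j - 1ℤ → i < j
i≤j-1⇒i<j {i} {j} p = i≤pred[j]⇒i<j (subst (i ≤_) (+-comm j -1ℤ) p)

i<j⇒i+1≤j : ∀ {i j} → i < j → i + 1ℤ ≤ j
i<j⇒i+1≤j {i} {j} p = subst (_≤ j) (+-comm 1ℤ i) (i<j⇒suc[i]≤j p)

i+1≤j⇒i<j : ∀ {i j} → i + 1ℤ ≤ j → i < j
i+1≤j⇒i<j {i} {j} p = suc[i]≤j⇒i<j (subst (_≤ j) (+-comm i 1ℤ) p)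

i-1<i : ∀ i → i - 1ℤ < i
i-1<i i = i≤j-1⇒i<j ≤-refl

i<i+1 : ∀ i → i < i + 1ℤ
i<i+1 i = i+1≤j⇒i<j ≤-refl

does≡true⇒ : ∀ {A : Set} (a? : Dec A) → does a? ≡ true → A
does≡true⇒ (yes a) _ = a
does≡true⇒ (no _)  ()

does≡false⇒¬ : ∀ {A : Set} (a? : Dec A) → does a? ≡ false → ¬ A
does≡false⇒¬ (yes _)  ()
does≡false⇒¬ (no ¬a) _ = ¬a

∉-∷ : ∀ {x y : ℤ} {ys} → x ≢ y → x ∉ ys → x ∉ y ∷ ys
∉-∷ x≢y _    (here x≡y)   = x≢y x≡y
∉-∷ _   x∉ys (there x∈ys) = x∉ys x∈ys

infix 4 _∈ᵇ_
_∈ᵇ_ : ℤ → Comp → Set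
x ∈ᵇ c = lo c ≤ x × x ≤ hi c

NonEmpty : Comp → Set
NonEmpty c = lo c ≤ hi c

hi+1≡lo+size : ∀ c → hi c + 1ℤ ≡ lo c + + size (tree c)
hi+1≡lo+size c = i-1+1≡i (lo c + + size (tree c))

lo≤hi+1 : ∀ c → lo c ≤ hi c + 1ℤ
lo≤hi+1 c = subst (lo c ≤_) (sym (hi+1≡lo+size c)) (i≤i+j (lo c) (+ size (tree c)))

Empty⇒hi+1≡lo : ∀ c → ¬ NonEmpty c → hi c + 1ℤ ≡ lo c
Empty⇒hi+1≡lo c empty = ≤-antisym (i<j⇒i+1≤j (≰⇒> empty)) (lo≤hi+1 c)

root⇒NonEmpty : ∀ {c w} → root (tree c) ≡ just w → NonEmpty c
root⇒NonEmpty {comp l (node t a u)} refl =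
  subst (l ≤_) (i+1-1≡i (hi c)) (i<j⇒i≤j-1 (subst (l <_) (sym (hi+1≡lo+size c)) l<l+size))
  where
  c = comp l (node t a u)
  l<l+size : l < l + + size (tree c)
  l<l+size = subst (_< l + + size (tree c)) (+-identityʳ l) (+-monoʳ-< l (+<+ (ℕ.s≤s ℕ.z≤n)))

>hi⇒∉ᵇ : ∀ {c x} → hi c < x → ¬ x ∈ᵇ c
>hi⇒∉ᵇ hi<x (_ , x≤hi) = ≤⇒≯ x≤hi hi<x

<lo⇒∉ᵇ : ∀ {c x} → x < lo c → ¬ x ∈ᵇ c
<lo⇒∉ᵇ x<lo (lo≤x , _) = ≤⇒≯ lo≤x x<lo

pred∈ᵇ⇒hi≡ : ∀ {m d} → m - 1ℤ ∈ᵇ d → ¬ m ∈ᵇ d → hi d ≡ m - 1ℤ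
pred∈ᵇ⇒hi≡ {m} {d} (lo≤ , ≤hi) m∉d = ≤-antisym (i<j⇒i≤j-1 hi<m) ≤hi
  where
  hi<m : hi d < m
  hi<m = ≰⇒> (λ m≤hi → m∉d (≤-trans lo≤ (<⇒≤ (i-1<i m)) , m≤hi))

suc∈ᵇ⇒lo≡ : ∀ {m d} → m + 1ℤ ∈ᵇ d → ¬ m ∈ᵇ d → lo d ≡ m + 1ℤ
suc∈ᵇ⇒lo≡ {m} {d} (lo≤ , ≤hi) m∉d = ≤-antisym lo≤ (i<j⇒i+1≤j m<lo)
  where
  m<lo : m < lo d
  m<lo = ≰⇒> (λ lo≤m → m∉d (lo≤m , ≤-trans (<⇒≤ (i<i+1 m)) ≤hi))

hi≡pred : ∀ ℓ {m} → hi ℓ + 1ℤ ≡ m → hi ℓ ≡ m - 1ℤ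
hi≡pred ℓ adj = trans (sym (i+1-1≡i (hi ℓ))) (cong (_- 1ℤ) adj)

hi<next : ∀ ℓ {m} → hi ℓ + 1ℤ ≡ m → hi ℓ < m
hi<next ℓ adj = subst (hi ℓ <_) adj (i<i+1 (hi ℓ))

lo≤next : ∀ ℓ {m} → hi ℓ + 1ℤ ≡ m → lo ℓ ≤ m
lo≤next ℓ adj = subst (lo ℓ ≤_) adj (lo≤hi+1 ℓ)

prev<lo : ∀ ρ {m} → lo ρ ≡ m + 1ℤ → m < lo ρ
prev<lo ρ {m} adj = subst (m <_) (sym adj) (i<i+1 m)

prev≤hi : ∀ ρ {m} → lo ρ ≡ m + 1ℤ → m ≤ hi ρ
prev≤hi ρ {m} adj = subst (m ≤_) (i+1-1≡i (hi ρ)) (i<j⇒i≤j-1 (<-≤-trans (prev<lo ρ adj) (lo≤hi+1 ρ)))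

∈-range⇔ : ∀ {z n x} → x ∈ range z n ⇔ (z ≤ x × x < z + + n)
∈-range⇔ {z} {n} {x} = mk⇔ to from
  where
  to : x ∈ range z n → z ≤ x × x < z + + n
  to p with ∈-map⁻ (λ k → z + + k) p
  ... | k , k∈ , refl = i≤i+j z (+ k) , +-monoʳ-< z (+<+ (∈-upTo⁻ k∈))
  from : z ≤ x × x < z + + n → x ∈ range z n
  from (z≤x , x<z+n) = subst (_∈ range z n) z+k≡x (∈-map⁺ (λ k → z + + k) (∈-upTo⁺ k<n))
    where
    k = ∣ x - z ∣
    +k≡x-z : + k ≡ x - z
    +k≡x-z = 0≤i⇒+∣i∣≡i (i≤j⇒0≤j-i z≤x)
    z+k≡x : z + + k ≡ x
    z+k≡x = trans (cong (λ t → z + t) +k≡x-z) (z+[x-z]≡x z x)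
      where
      z+[x-z]≡x : ∀ z x → z + (x - z) ≡ x
      z+[x-z]≡x = solve-∀
    k<n : k ℕ.< n
    k<n = drop‿+<+ (subst₂ _<_ (sym +k≡x-z) (z+n-z≡n z (+ n)) (+-monoˡ-< (- z) x<z+n))
      where
      z+n-z≡n : ∀ z n → z + n - z ≡ n
      z+n-z≡n = solve-∀

∈-block⇔ : ∀ {c x} → x ∈ block c ⇔ x ∈ᵇ c
∈-block⇔ {c} = mk⇔ (λ p → let (l≤x , x<) = Equivalence.to ∈-range⇔ p in l≤x , i<j⇒i≤j-1 x<)
                   (λ (l≤x , x≤h) → Equivalence.from ∈-range⇔ (l≤x , i≤j-1⇒i<j x≤h))

∈-Supp⇔ : ∀ {F x} → x ∈ Supp F ⇔ Any (x ∈ᵇ_) F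
∈-Supp⇔ = mk⇔ (Any.map (Equivalence.to ∈-block⇔) ∘ concatMap⁻ _)
              (concatMap⁺ _ ∘ Any.map (Equivalence.from ∈-block⇔))

inBlock⇒∈ᵇ : ∀ {i c} → inBlock i c ≡ true → i ∈ᵇ c
inBlock⇒∈ᵇ {i} {c} = does≡true⇒ ((lo c ≤? i) ×-dec (i ≤? hi c))

joinAt : Comp → Letter → Comp → Comp
joinAt ℓ a ρ = comp (lo ℓ) (node (tree ℓ) a (tree ρ))

-- An absent neighbour is treated as an empty component, so that all three insertion cases
-- become one join.
emptyAt : ℤ → Comp
emptyAt z = comp z leaf

orEmptyAt : Maybe Comp → ℤ → Comp
orEmptyAt X z = comp (loOr X z) (treeOr X)

hi-emptyAt+1 : ∀ z → hi (emptyAt z) + 1ℤ ≡ z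
hi-emptyAt+1 z = trans (hi+1≡lo+size (emptyAt z)) (+-identityʳ z)

∉ᵇ-emptyAt : ∀ {x z} → ¬ x ∈ᵇ emptyAt z
∉ᵇ-emptyAt {x} {z} (z≤x , x≤hi) =
  ≤⇒≯ z≤x (≤-<-trans x≤hi (subst (hi (emptyAt z) <_) (hi-emptyAt+1 z) (i<i+1 _)))

-- Forests whose blocks are the maximal intervals of a set

nodes : Forest → ℕ
nodes F = sum (map (size ∘ tree) F)

Disjoint : Comp → Comp → Set
Disjoint c d = ∀ {x} → x ∈ᵇ c → x ∈ᵇ d → ⊥

Disjoint-sym : ∀ {c d} → Disjoint c d → Disjoint d c
Disjoint-sym c#d x∈d x∈c = c#d x∈c x∈d

Maximal : List ℤ → Comp → Set
Maximal S c = lo c - 1ℤ ∉ S × hi c + 1ℤ ∉ S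

record Layout (F : Forest) (S : List ℤ) : Set where
  field
    supp     : Supp F ≐ S
    -- bounds every block by length S, the fuel Ω gives lowEnd and highEnd
    count    : nodes F ≡ length S
    disjoint : AllPairs Disjoint F
    maximal  : All (Maximal S) F

  ∈ᵇ⇒∈S : ∀ {c x} → c ∈ F → x ∈ᵇ c → x ∈ S
  ∈ᵇ⇒∈S c∈F x∈c = Equivalence.to (supp _) (Equivalence.from ∈-Supp⇔ (lose c∈F x∈c))

Supp-resp-↭ : ∀ {F F′ x} → F ↭ F′ → x ∈ Supp F → x ∈ Supp F′
Supp-resp-↭ F↭F′ = Equivalence.from ∈-Supp⇔ ∘ Any-resp-↭ F↭F′ ∘ Equivalence.to ∈-Supp⇔

Layout-resp-↭ : ∀ {F F′ S} → F ↭ F′ → Layout F S → Layout F′ S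
Layout-resp-↭ F↭F′ lay = record
  { supp     = λ x → mk⇔ (Equivalence.to (supp x) ∘ Supp-resp-↭ (↭-sym F↭F′))
                         (Supp-resp-↭ F↭F′ ∘ Equivalence.from (supp x))
  ; count    = trans (sym (sum-↭ (map⁺ (size ∘ tree) F↭F′))) count
  ; disjoint = AllPairs-resp-↭ Disjoint-sym (resp₂ Disjoint) (↭⇒↭ₛ F↭F′) disjoint
  ; maximal  = All-resp-↭ F↭F′ maximal
  }
  where open Layout lay

outside⇒∉ : ∀ {F S i} → Layout F S → All (λ d → inBlock i d ≡ false) F → i ∉ S
outside⇒∉ {i = i} lay outside i∈S
  with d , d∈F , i∈d ← find (Equivalence.to ∈-Supp⇔ (Equivalence.from (Layout.supp lay i) i∈S)) =
  does≡false⇒¬ ((lo d ≤? i) ×-dec (i ≤? hi d)) (All.lookup outside d∈F) i∈d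

loᶜ≢lo : ∀ {S c d} → Maximal S c → Disjoint c d → NonEmpty d → lo d ∈ S → lo c ≢ lo d
loᶜ≢lo {S} {c} {d} (_ , hi+1∉S) c#d d≠∅ lo∈S lo≡ with lo c ≤? hi c
... | yes c≠∅ = c#d (subst (lo c ≤_) lo≡ ≤-refl , subst (_≤ hi c) lo≡ c≠∅) (≤-refl , d≠∅)
... | no c=∅  = hi+1∉S (subst (_∈ S) (sym (trans (Empty⇒hi+1≡lo c c=∅) lo≡)) lo∈S)

hiᶜ≢hi : ∀ {S c d} → Maximal S c → Disjoint c d → NonEmpty d → hi d ∈ S → hi c ≢ hi d
hiᶜ≢hi {S} {c} {d} (lo-1∉S , _) c#d d≠∅ hi∈S hi≡ with lo c ≤? hi c
... | yes c≠∅ = c#d (subst (lo c ≤_) hi≡ c≠∅ , subst (_≤ hi c) hi≡ ≤-refl) (d≠∅ , ≤-refl)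
... | no c=∅  = lo-1∉S (subst (_∈ S) lo-1≡hi hi∈S)
  where
  lo-1≡hi : hi d ≡ lo c - 1ℤ
  lo-1≡hi = trans (sym hi≡) (trans (sym (i+1-1≡i (hi c))) (cong (_- 1ℤ) (Empty⇒hi+1≡lo c c=∅)))

module _ {ℓ ρ : Comp} {m : ℤ} (adjˡ : hi ℓ + 1ℤ ≡ m) (adjʳ : lo ρ ≡ m + 1ℤ) where

  hi-joinAt : ∀ a → hi (joinAt ℓ a ρ) ≡ hi ρ
  hi-joinAt a = begin
    lo ℓ + + suc (sˡ ℕ.+ sʳ) - 1ℤ ≡⟨ i+[1+n]-1≡i+n (lo ℓ) (sˡ ℕ.+ sʳ) ⟩
    lo ℓ + + (sˡ ℕ.+ sʳ)          ≡⟨ cong (λ t → lo ℓ + t) (pos-+ sˡ sʳ) ⟩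
    lo ℓ + (+ sˡ + + sʳ)          ≡⟨ sym (+-assoc (lo ℓ) (+ sˡ) (+ sʳ)) ⟩
    lo ℓ + + sˡ + + sʳ            ≡⟨ cong (_+ + sʳ) (trans (sym (hi+1≡lo+size ℓ)) adjˡ) ⟩
    m + + sʳ                      ≡⟨ shift₁ m (+ sʳ) ⟩
    m + 1ℤ + + sʳ - 1ℤ            ≡⟨ cong (λ t → t + + sʳ - 1ℤ) (sym adjʳ) ⟩
    lo ρ + + sʳ - 1ℤ              ∎
    where
    open ≡-Reasoning
    sˡ = size (tree ℓ)
    sʳ = size (tree ρ)
    shift₁ : ∀ i j → i + j ≡ i + 1ℤ + j - 1ℤ
    shift₁ = solve-∀

  ∈ᵇ-joinAt⇔ : ∀ {a x} → x ∈ᵇ joinAt ℓ a ρ ⇔ (x ∈ᵇ ℓ ⊎ x ≡ m ⊎ x ∈ᵇ ρ)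
  ∈ᵇ-joinAt⇔ {a} {x} = mk⇔ to from
    where
    to : x ∈ᵇ joinAt ℓ a ρ → x ∈ᵇ ℓ ⊎ x ≡ m ⊎ x ∈ᵇ ρ
    to (lo≤x , x≤hi) with <-cmp x m
    ... | tri< x<m _ _ = inj₁ (lo≤x , subst (x ≤_) (sym (hi≡pred ℓ adjˡ)) (i<j⇒i≤j-1 x<m))
    ... | tri≈ _ x≡m _ = inj₂ (inj₁ x≡m)
    ... | tri> _ _ m<x = inj₂ (inj₂ (subst (_≤ x) (sym adjʳ) (i<j⇒i+1≤j m<x) , subst (x ≤_) (hi-joinAt a) x≤hi))
    below-hi : x ≤ hi ρ → x ≤ hi (joinAt ℓ a ρ)
    below-hi = subst (x ≤_) (sym (hi-joinAt a))
    from : x ∈ᵇ ℓ ⊎ x ≡ m ⊎ x ∈ᵇ ρ → x ∈ᵇ joinAt ℓ a ρ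
    from (inj₁ (lo≤x , x≤hi))        = lo≤x , below-hi (≤-trans x≤hi (≤-trans (<⇒≤ (hi<next ℓ adjˡ)) (prev≤hi ρ adjʳ)))
    from (inj₂ (inj₁ refl))          = (lo≤next ℓ adjˡ) , below-hi (prev≤hi ρ adjʳ)
    from (inj₂ (inj₂ (lo≤x , x≤hi))) = ≤-trans (lo≤next ℓ adjˡ) (≤-trans (<⇒≤ (prev<lo ρ adjʳ)) lo≤x) , below-hi x≤hi

  module _ {a : Letter} {G : Forest} {S : List ℤ} (lay : Layout (ℓ ∷ ρ ∷ G) S) (m∉S : m ∉ S) where

    open Layout lay
    private
      N = joinAt ℓ a ρ
      ∈ᴺ⇔ : ∀ {x} → x ∈ᵇ N ⇔ (x ∈ᵇ ℓ ⊎ x ≡ m ⊎ x ∈ᵇ ρ)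
      ∈ᴺ⇔ = ∈ᵇ-joinAt⇔ {a}
      ℓ#G : All (Disjoint ℓ) G
      ℓ#G = All.tail (AllPairs.head disjoint)
      ρ#G : All (Disjoint ρ) G
      ρ#G = AllPairs.head (AllPairs.tail disjoint)
      maxˡ = All.head maximal
      maxʳ = All.head (All.tail maximal)
      inS : ∀ {x} → Any (x ∈ᵇ_) (ℓ ∷ ρ ∷ G) → x ∈ S
      inS {x} = Equivalence.to (supp x) ∘ Equivalence.from ∈-Supp⇔
      G⊆S : ∀ {d x} → d ∈ G → x ∈ᵇ d → x ∈ S
      G⊆S d∈G = ∈ᵇ⇒∈S (there (there d∈G))

    supp-joinAt : Supp (N ∷ G) ≐ (m ∷ S)
    supp-joinAt x = mk⇔ to (Equivalence.from (∈-Supp⇔ {N ∷ G}) ∘ from)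
      where
      to : x ∈ Supp (N ∷ G) → x ∈ m ∷ S
      to p with Equivalence.to (∈-Supp⇔ {N ∷ G}) p
      ... | there x∈G = there (inS (there (there x∈G)))
      ... | here x∈N with Equivalence.to ∈ᴺ⇔ x∈N
      ...   | inj₁ x∈ℓ        = there (inS (here x∈ℓ))
      ...   | inj₂ (inj₁ x≡m) = here x≡m
      ...   | inj₂ (inj₂ x∈ρ) = there (inS (there (here x∈ρ)))
      from : x ∈ m ∷ S → Any (x ∈ᵇ_) (N ∷ G)
      from (here x≡m) = here (Equivalence.from ∈ᴺ⇔ (inj₂ (inj₁ x≡m)))
      from (there x∈S) with Equivalence.to (∈-Supp⇔ {ℓ ∷ ρ ∷ G}) (Equivalence.from (supp x) x∈S)
      ... | here x∈ℓ          = here (Equivalence.from ∈ᴺ⇔ (inj₁ x∈ℓ))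
      ... | there (here x∈ρ)  = here (Equivalence.from ∈ᴺ⇔ (inj₂ (inj₂ x∈ρ)))
      ... | there (there x∈G) = there x∈G

    joinAt#G : All (Disjoint N) G
    joinAt#G = All.tabulate N#d
      where
      N#d : ∀ {d} → d ∈ G → Disjoint N d
      N#d d∈G x∈N x∈d with Equivalence.to ∈ᴺ⇔ x∈N
      ... | inj₁ x∈ℓ         = All.lookup ℓ#G d∈G x∈ℓ x∈d
      ... | inj₂ (inj₁ refl) = m∉S (G⊆S d∈G x∈d)
      ... | inj₂ (inj₂ x∈ρ)  = All.lookup ρ#G d∈G x∈ρ x∈d

    Maximal-joinAt : Maximal (m ∷ S) N
    Maximal-joinAt =
      ∉-∷ (<⇒≢ (<-≤-trans (i-1<i (lo ℓ)) (lo≤next ℓ adjˡ))) (proj₁ maxˡ) ,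
      subst (λ h → h + 1ℤ ∉ m ∷ S) (sym (hi-joinAt a))
        (∉-∷ (≢-sym (<⇒≢ (≤-<-trans (prev≤hi ρ adjʳ) (i<i+1 (hi ρ))))) (proj₂ maxʳ))

    -- a block of G next to m would share an end with ℓ or ρ
    Maximal-besides-joinAt : All NonEmpty G → All (Maximal (m ∷ S)) G
    Maximal-besides-joinAt G≠∅ = All.tabulate maximalᵈ
      where
      maximalᵈ : ∀ {d} → d ∈ G → Maximal (m ∷ S) d
      maximalᵈ {d} d∈G = ∉-∷ lo-1≢m (proj₁ maxᵈ) , ∉-∷ hi+1≢m (proj₂ maxᵈ)
        where
        maxᵈ = All.lookup (All.tail (All.tail maximal)) d∈G
        d≠∅ = All.lookup G≠∅ d∈G
        lo-1≢m : lo d - 1ℤ ≢ m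
        lo-1≢m lo-1≡m = loᶜ≢lo maxʳ (All.lookup ρ#G d∈G) d≠∅ (G⊆S d∈G (≤-refl , d≠∅))
          (trans adjʳ (trans (cong (_+ 1ℤ) (sym lo-1≡m)) (i-1+1≡i (lo d))))
        hi+1≢m : hi d + 1ℤ ≢ m
        hi+1≢m hi+1≡m = hiᶜ≢hi maxˡ (All.lookup ℓ#G d∈G) d≠∅ (G⊆S d∈G (d≠∅ , ≤-refl))
          (trans (hi≡pred ℓ adjˡ) (trans (cong (_- 1ℤ) (sym hi+1≡m)) (i+1-1≡i (hi d))))

    Layout-joinAt : All NonEmpty G → Layout (N ∷ G) (m ∷ S)
    Layout-joinAt G≠∅ = record
      { supp     = supp-joinAt
      ; count    = cong suc (trans (ℕ.+-assoc (size (tree ℓ)) (size (tree ρ)) (nodes G)) count)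
      ; disjoint = joinAt#G ∷ AllPairs.tail (AllPairs.tail disjoint)
      ; maximal  = Maximal-joinAt ∷ Maximal-besides-joinAt G≠∅
      }

Maximal-emptyAt : ∀ {S z} → z - 1ℤ ∉ S → z ∉ S → Maximal S (emptyAt z)
Maximal-emptyAt {S} {z} z-1∉S z∉S = z-1∉S , subst (_∉ S) (sym (hi-emptyAt+1 z)) z∉S

Layout-emptyAt : ∀ {G S z} → Layout G S → Maximal S (emptyAt z) → Layout (emptyAt z ∷ G) S
Layout-emptyAt lay max = record
  { supp     = supp
  ; count    = count
  ; disjoint = All.tabulate (λ _ x∈∅ _ → ∉ᵇ-emptyAt x∈∅) ∷ disjoint
  ; maximal  = max ∷ maximal
  }
  where open Layout lay

lowEnd-maximal : ∀ n {S c x} → (∀ {y} → y ∈ᵇ c → y ∈ S) → lo c - 1ℤ ∉ S →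
  x ∈ᵇ c → x ≤ lo c + + n → lowEnd n S x ≡ lo c
lowEnd-maximal n {S} {c} {x} c⊆S lo-1∉S (lo≤x , x≤hi) x≤lo+n with x ≟ lo c
... | yes refl = atLo n
  where
  atLo : ∀ n → lowEnd n S (lo c) ≡ lo c
  atLo zero = refl
  atLo (suc n) with (lo c - 1ℤ) ∈? S
  ... | yes lo-1∈S = ⊥-elim (lo-1∉S lo-1∈S)
  ... | no _       = refl
... | no x≢lo = stepDown n x≤lo+n
  where
  lo<x : lo c < x
  lo<x = ≤∧≢⇒< lo≤x (x≢lo ∘ sym)
  x-1∈c : x - 1ℤ ∈ᵇ c
  x-1∈c = i<j⇒i≤j-1 lo<x , ≤-trans (i-j≤i x 1ℤ) x≤hi
  stepDown : ∀ n → x ≤ lo c + + n → lowEnd n S x ≡ lo c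
  stepDown zero x≤lo = ⊥-elim (≤⇒≯ (subst (x ≤_) (+-identityʳ (lo c)) x≤lo) lo<x)
  stepDown (suc n) x≤ with (x - 1ℤ) ∈? S
  ... | yes _      = lowEnd-maximal n c⊆S lo-1∉S x-1∈c
                       (subst (x - 1ℤ ≤_) (i+[1+n]-1≡i+n (lo c) n) (+-monoˡ-≤ -1ℤ x≤))
  ... | no x-1∉S = ⊥-elim (x-1∉S (c⊆S x-1∈c))

highEnd-maximal : ∀ n {S c x} → (∀ {y} → y ∈ᵇ c → y ∈ S) → hi c + 1ℤ ∉ S →
  x ∈ᵇ c → hi c ≤ x + + n → highEnd n S x ≡ hi c
highEnd-maximal n {S} {c} {x} c⊆S hi+1∉S (lo≤x , x≤hi) hi≤x+n with x ≟ hi c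
... | yes refl = atHi n
  where
  atHi : ∀ n → highEnd n S (hi c) ≡ hi c
  atHi zero = refl
  atHi (suc n) with (hi c + 1ℤ) ∈? S
  ... | yes hi+1∈S = ⊥-elim (hi+1∉S hi+1∈S)
  ... | no _       = refl
... | no x≢hi = stepUp n hi≤x+n
  where
  x<hi : x < hi c
  x<hi = ≤∧≢⇒< x≤hi x≢hi
  x+1∈c : x + 1ℤ ∈ᵇ c
  x+1∈c = ≤-trans lo≤x (i≤i+j x 1ℤ) , i<j⇒i+1≤j x<hi
  stepUp : ∀ n → hi c ≤ x + + n → highEnd n S x ≡ hi c
  stepUp zero hi≤x = ⊥-elim (≤⇒≯ (subst (hi c ≤_) (+-identityʳ x) hi≤x) x<hi)
  stepUp (suc n) hi≤ with (x + 1ℤ) ∈? S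
  ... | yes _      = highEnd-maximal n c⊆S hi+1∉S x+1∈c (subst (hi c ≤_) (i+[1+n]≡i+1+n x n) hi≤)
  ... | no x+1∉S = ⊥-elim (x+1∉S (c⊆S x+1∈c))

lowEnd-highEnd : ∀ {c G S x} → Layout (c ∷ G) S → x ∈ᵇ c →
  lowEnd (length S) S x ≡ lo c × highEnd (length S) S x ≡ hi c
lowEnd-highEnd {c} {G} {S} {x} lay x∈c =
  lowEnd-maximal (length S) c⊆S (proj₁ (All.head maximal)) x∈c x≤lo+|S| ,
  highEnd-maximal (length S) c⊆S (proj₂ (All.head maximal)) x∈c hi≤x+|S|
  where
  open Layout lay
  c⊆S : ∀ {y} → y ∈ᵇ c → y ∈ S
  c⊆S = ∈ᵇ⇒∈S (here refl)
  hi<lo+|S| : hi c < lo c + + length S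
  hi<lo+|S| = begin-strict
    hi c                   <⟨ i<i+1 (hi c) ⟩
    hi c + 1ℤ              ≡⟨ hi+1≡lo+size c ⟩
    lo c + + size (tree c) ≤⟨ +-monoʳ-≤ (lo c) (+≤+ (subst (size (tree c) ℕ.≤_) count (ℕ.m≤m+n _ _))) ⟩
    lo c + + length S      ∎
    where open ≤-Reasoning
  x≤lo+|S| : x ≤ lo c + + length S
  x≤lo+|S| = <⇒≤ (≤-<-trans (proj₂ x∈c) hi<lo+|S|)
  hi≤x+|S| : hi c ≤ x + + length S
  hi≤x+|S| = ≤-trans (<⇒≤ hi<lo+|S|) (+-monoˡ-≤ (+ length S) (proj₁ x∈c))

-- Root labels

RootIsLast : List Letter → Comp → Set
RootIsLast pre c = ∃ λ w → root (tree c) ≡ just w × lastIn (lo c) (hi c) pre ≡ just w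

record Invariant (F : Forest) (S : List ℤ) (pre : List Letter) : Set where
  field
    layout    : Layout F S
    rootsLast : All (RootIsLast pre) F

Invariant-resp-↭ : ∀ {F F′ S pre} → F ↭ F′ → Invariant F S pre → Invariant F′ S pre
Invariant-resp-↭ F↭F′ inv = record
  { layout = Layout-resp-↭ F↭F′ layout ; rootsLast = All-resp-↭ F↭F′ rootsLast }
  where open Invariant inv

RootIsLast⇒NonEmpty : ∀ {pre c} → RootIsLast pre c → NonEmpty c
RootIsLast⇒NonEmpty (_ , root≡ , _) = root⇒NonEmpty root≡

Maximal-head : ∀ {c G S pre} → Invariant (c ∷ G) S pre → Maximal S c
Maximal-head inv = All.head (Layout.maximal (Invariant.layout inv))

lastIn-hit : ∀ {l h a pre} → l ≤ val a → val a ≤ h → lastIn l h (a ∷ pre) ≡ just a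
lastIn-hit {l} {h} {a} l≤a a≤h with l ≤? val a | val a ≤? h
... | yes _   | yes _   = refl
... | yes _   | no a≰h = ⊥-elim (a≰h a≤h)
... | no l≰a | _       = ⊥-elim (l≰a l≤a)

lastIn-miss : ∀ {l h a pre} → ¬ (l ≤ val a × val a ≤ h) → lastIn l h (a ∷ pre) ≡ lastIn l h pre
lastIn-miss {l} {h} {a} a∉ with l ≤? val a | val a ≤? h
... | yes l≤a | yes a≤h = ⊥-elim (a∉ (l≤a , a≤h))
... | yes _   | no _    = refl
... | no _    | _       = refl

rootsLast-∷ : ∀ {N G pre a} → root (tree N) ≡ just a → val a ∈ᵇ N → All (Disjoint N) G →
  All (RootIsLast pre) G → All (RootIsLast (a ∷ pre)) (N ∷ G)
rootsLast-∷ {N} {G} {pre} {a} root≡a a∈N N#G rootsG =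
  (a , root≡a , lastIn-hit {pre = pre} (proj₁ a∈N) (proj₂ a∈N)) ∷ All.tabulate rootLast
  where
  rootLast : ∀ {d} → d ∈ G → RootIsLast (a ∷ pre) d
  rootLast d∈G with w , root≡w , last≡w ← All.lookup rootsG d∈G =
    w , root≡w , trans (lastIn-miss {pre = pre} (All.lookup N#G d∈G a∈N)) last≡w

Invariant-joinAt : ∀ {ℓ ρ m a G S pre} → hi ℓ + 1ℤ ≡ m → lo ρ ≡ m + 1ℤ →
  Layout (ℓ ∷ ρ ∷ G) S → All (RootIsLast pre) G → m ∉ S → val a ∈ᵇ joinAt ℓ a ρ →
  Invariant (joinAt ℓ a ρ ∷ G) (m ∷ S) (a ∷ pre)
Invariant-joinAt {a = a} {pre = pre} adjˡ adjʳ lay rootsG m∉S a∈N = record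
  { layout    = Layout-joinAt adjˡ adjʳ lay m∉S (All.map (RootIsLast⇒NonEmpty {pre}) rootsG)
  ; rootsLast = rootsLast-∷ {pre = pre} refl a∈N (joinAt#G adjˡ adjʳ {a} lay m∉S) rootsG
  }

belowRoot-root : ∀ a c {w} → root (tree c) ≡ just w → belowRoot a c ≡ does (a <ᴸ? w)
belowRoot-root a (comp l (node _ w _)) refl = refl

Ωstep-fresh : ∀ S pre a → val a ∉ S → Ωstep S pre a ≡ val a ∷ S
Ωstep-fresh S pre a a∉S with val a ∈? S
... | yes a∈S = ⊥-elim (a∉S a∈S)
... | no _    = refl

Ωstep-inside : ∀ {c G S pre a b} → Invariant (c ∷ G) S pre → val a ∈ᵇ c → belowRoot a c ≡ b →
  Ωstep S pre a ≡ (if b then (lo c - 1ℤ) ∷ S else (hi c + 1ℤ) ∷ S)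
Ωstep-inside {c} {G} {S} {pre} {a} inv a∈c below with val a ∈? S
... | no a∉S = ⊥-elim (a∉S (Layout.∈ᵇ⇒∈S (Invariant.layout inv) (here refl) a∈c))
... | yes _ with w , root≡w , last≡w ← All.head (Invariant.rootsLast inv)
  rewrite proj₁ (lowEnd-highEnd (Invariant.layout inv) a∈c)
        | proj₂ (lowEnd-highEnd (Invariant.layout inv) a∈c)
        | last≡w =
  cong (λ b → if b then (lo c - 1ℤ) ∷ S else (hi c + 1ℤ) ∷ S) (trans (sym (belowRoot-root a c root≡w)) below)

Picked : (Comp → Bool) → Forest → Maybe Comp → Forest → Set
Picked p F nothing  F′ = F′ ≡ F × All (λ c → p c ≡ false) F
Picked p F (just c) F′ = F ↭ c ∷ F′ × p c ≡ true

pick-Picked : ∀ p F → Picked p F (proj₁ (pick p F)) (proj₂ (pick p F))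
pick-Picked p [] = refl , []
pick-Picked p (c ∷ F) with p c in pc
... | true = ↭-refl , pc
... | false with pick p F | pick-Picked p F
...   | nothing , F′ | F′≡F , none   = cong (c ∷_) F′≡F , pc ∷ none
...   | just d , F′  | F↭dF′ , pd    = ↭-trans (↭-prep c F↭dF′) (↭-swap c d ↭-refl) , pd

Picked-All : ∀ {P : Comp → Set} {p F X F′} → Picked p F X F′ → All P F → All P F′
Picked-All {X = nothing} (refl , _) all = all
Picked-All {X = just c}  (F↭ , _)   all = All.tail (All-resp-↭ F↭ all)

endsAt : ℤ → Comp → Bool
endsAt z c = does (hi c ≟ z)

startsAt : ℤ → Comp → Bool
startsAt z c = does (lo c ≟ z)

pick-leftNeighbour : ∀ {H G L G′ S m} → Layout (H ++ G) S → m ∉ S → All (λ c → ¬ m - 1ℤ ∈ᵇ c) H →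
  Picked (endsAt (m - 1ℤ)) G L G′ →
  Layout (orEmptyAt L m ∷ H ++ G′) S × hi (orEmptyAt L m) + 1ℤ ≡ m
pick-leftNeighbour {H} {L = just l} {G′} {m = m} lay _ _ (G↭lG′ , ends) =
  Layout-resp-↭ (↭-trans (++⁺ˡ H G↭lG′) (shift l H G′)) lay ,
  trans (cong (_+ 1ℤ) (does≡true⇒ (hi l ≟ m - 1ℤ) ends)) (i-1+1≡i m)
pick-leftNeighbour {H} {L = nothing} {S = S} {m} lay m∉S H∌ (refl , none) =
  Layout-emptyAt lay (Maximal-emptyAt m-1∉S m∉S) , hi-emptyAt+1 m
  where
  open Layout lay
  m-1∉S : m - 1ℤ ∉ S
  m-1∉S m-1∈S with ++⁻ H (Equivalence.to ∈-Supp⇔ (Equivalence.from (supp _) m-1∈S))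
  ... | inj₁ inH = All¬⇒¬Any H∌ inH
  ... | inj₂ inG with d , d∈G , m-1∈d ← find inG =
    does≡false⇒¬ (hi d ≟ m - 1ℤ) (All.lookup none d∈G)
      (pred∈ᵇ⇒hi≡ m-1∈d (m∉S ∘ ∈ᵇ⇒∈S (∈-++⁺ʳ H d∈G)))

pick-rightNeighbour : ∀ {H G R G′ S m} → Layout (H ++ G) S → m ∉ S → All (λ c → ¬ m + 1ℤ ∈ᵇ c) H →
  Picked (startsAt (m + 1ℤ)) G R G′ →
  Layout (H ++ orEmptyAt R (m + 1ℤ) ∷ G′) S × lo (orEmptyAt R (m + 1ℤ)) ≡ m + 1ℤ
pick-rightNeighbour {H} {R = just r} {m = m} lay _ _ (G↭rG′ , starts) =
  Layout-resp-↭ (++⁺ˡ H G↭rG′) lay , does≡true⇒ (lo r ≟ m + 1ℤ) starts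
pick-rightNeighbour {H} {G} {R = nothing} {S = S} {m} lay m∉S H∌ (refl , none) =
  Layout-resp-↭ (↭-sym (shift (emptyAt (m + 1ℤ)) H G))
    (Layout-emptyAt lay (Maximal-emptyAt (subst (_∉ S) (sym (i+1-1≡i m)) m∉S) m+1∉S)) ,
  refl
  where
  open Layout lay
  m+1∉S : m + 1ℤ ∉ S
  m+1∉S m+1∈S with ++⁻ H (Equivalence.to ∈-Supp⇔ (Equivalence.from (supp _) m+1∈S))
  ... | inj₁ inH = All¬⇒¬Any H∌ inH
  ... | inj₂ inG with d , d∈G , m+1∈d ← find inG =
    does≡false⇒¬ (lo d ≟ m + 1ℤ) (All.lookup none d∈G)
      (suc∈ᵇ⇒lo≡ m+1∈d (m∉S ∘ ∈ᵇ⇒∈S (∈-++⁺ʳ H d∈G)))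

-- Insertion

insert-fresh : ∀ {F S pre a L F₁ R F₂} → Invariant F S pre → val a ∉ S →
  Picked (endsAt (val a - 1ℤ)) F L F₁ → Picked (startsAt (val a + 1ℤ)) F₁ R F₂ →
  Invariant (joinAt (orEmptyAt L (val a)) a (orEmptyAt R (val a + 1ℤ)) ∷ F₂) (val a ∷ S) (a ∷ pre)
insert-fresh {a = a} {L} inv a∉S pickedL pickedR
  with layoutᴸ , adjˡ ← pick-leftNeighbour {H = []} (Invariant.layout inv) a∉S [] pickedL
  with layoutᴸᴿ , adjʳ ← pick-rightNeighbour {H = [ orEmptyAt L (val a) ]} layoutᴸ a∉S
         (>hi⇒∉ᵇ (<-trans (hi<next (orEmptyAt L (val a)) adjˡ) (i<i+1 (val a))) ∷ []) pickedR
  = Invariant-joinAt adjˡ adjʳ layoutᴸᴿ (Picked-All pickedR (Picked-All pickedL (Invariant.rootsLast inv))) a∉S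
      (Equivalence.from (∈ᵇ-joinAt⇔ adjˡ adjʳ {a}) (inj₂ (inj₁ refl)))

insert-after : ∀ {c G S pre a R G′} → Invariant (c ∷ G) S pre → val a ∈ᵇ c →
  Picked (startsAt (hi c + 1ℤ + 1ℤ)) G R G′ →
  Invariant (joinAt c a (orEmptyAt R (hi c + 1ℤ + 1ℤ)) ∷ G′) ((hi c + 1ℤ) ∷ S) (a ∷ pre)
insert-after {c} {a = a} inv a∈c pickedR
  with layoutᴿ , adjʳ ← pick-rightNeighbour {H = [ c ]} (Invariant.layout inv) (proj₂ (Maximal-head inv))
         (>hi⇒∉ᵇ (<-trans (i<i+1 (hi c)) (i<i+1 (hi c + 1ℤ))) ∷ []) pickedR
  = Invariant-joinAt refl adjʳ layoutᴿ (Picked-All pickedR (All.tail (Invariant.rootsLast inv)))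
      (proj₂ (Maximal-head inv)) (Equivalence.from (∈ᵇ-joinAt⇔ refl adjʳ {a}) (inj₁ a∈c))

insert-before : ∀ {c G S pre a L G′} → Invariant (c ∷ G) S pre → val a ∈ᵇ c →
  Picked (endsAt (lo c - 1ℤ - 1ℤ)) G L G′ →
  Invariant (joinAt (orEmptyAt L (lo c - 1ℤ)) a c ∷ G′) ((lo c - 1ℤ) ∷ S) (a ∷ pre)
insert-before {c} {a = a} inv a∈c pickedL
  with layoutᴸ , adjˡ ← pick-leftNeighbour {H = [ c ]} (Invariant.layout inv) (proj₁ (Maximal-head inv))
         (<lo⇒∉ᵇ (<-trans (i-1<i (lo c - 1ℤ)) (i-1<i (lo c))) ∷ []) pickedL
  = Invariant-joinAt adjˡ adjʳ layoutᴸ (Picked-All pickedL (All.tail (Invariant.rootsLast inv)))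
      (proj₁ (Maximal-head inv)) (Equivalence.from (∈ᵇ-joinAt⇔ adjˡ adjʳ {a}) (inj₂ (inj₂ a∈c)))
  where
  adjʳ : lo c ≡ lo c - 1ℤ + 1ℤ
  adjʳ = sym (i-1+1≡i (lo c))

insert-Invariant : ∀ {F S pre} → Invariant F S pre → ∀ a → Invariant (insert F a) (Ωstep S pre a) (a ∷ pre)
insert-Invariant {F} {S} {pre} inv a with pick (inBlock (val a)) F | pick-Picked (inBlock (val a)) F
... | nothing , _ | _ , outside with a∉S ← outside⇒∉ (Invariant.layout inv) outside =
  subst (λ T → Invariant _ T (a ∷ pre)) (sym (Ωstep-fresh S pre a a∉S))
    (insert-fresh inv a∉S (pick-Picked (endsAt (val a - 1ℤ)) F) (pick-Picked (startsAt (val a + 1ℤ)) F₁))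
  where
  F₁ = proj₂ (pick (endsAt (val a - 1ℤ)) F)
... | just c , F₁ | F↭cF₁ , inside
  with inv′ ← Invariant-resp-↭ F↭cF₁ inv | a∈c ← inBlock⇒∈ᵇ inside | belowRoot a c in below
... | false = subst (λ T → Invariant _ T (a ∷ pre)) (sym (Ωstep-inside inv′ a∈c below))
                (insert-after inv′ a∈c (pick-Picked _ F₁))
... | true  = subst (λ T → Invariant _ T (a ∷ pre)) (sym (Ωstep-inside inv′ a∈c below))
                (insert-before inv′ a∈c (pick-Picked _ F₁))

Invariant-[] : Invariant [] [] []
Invariant-[] = record
  { layout    = record { supp = λ _ → mk⇔ (λ ()) (λ ()) ; count = refl ; disjoint = [] ; maximal = [] }
  ; rootsLast = []
  }

Supp-foldl≐Ωgo : ∀ W {F S pre} → Invariant F S pre → Supp (foldl insert F W) ≐ Ωgo W S pre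
Supp-foldl≐Ωgo []      inv = Layout.supp (Invariant.layout inv)
Supp-foldl≐Ωgo (a ∷ W) inv = Supp-foldl≐Ωgo W (insert-Invariant inv a)

≐⇒IsOneTo⇔ : ∀ {A B n} → A ≐ B → IsOneTo B n ⇔ IsOneTo A n
≐⇒IsOneTo⇔ A≐B = mk⇔ (λ oneTo x → ⇔-trans (A≐B x) (oneTo x)) (λ oneTo x → ⇔-trans (⇔-sym (A≐B x)) (oneTo x))

proposition5p3 : (W : Word) → Unique W →
    (Supp (F W) ≐ Ω W) × (ΩParking W ⇔ IsOneTo (Supp (F W)) (length W))
proposition5p3 W _ = Supp≐Ω , ≐⇒IsOneTo⇔ Supp≐Ω
  where
  Supp≐Ω : Supp (F W) ≐ Ω W
  Supp≐Ω = Supp-foldl≐Ωgo W Invariant-[]
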